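{- For all terms $s_1,s_2,s_3$: if $s_1\to_{R_h,AC}s_2$ and $s_2\to_{R_2,ACh}s_3$, then $s_1$ is also reducible by $\to_{R_2,ACh}$.
   Context: Terms are over $\{+,h,0\}$, variables and free constants. $R_2$ is the rewrite system $x+x\to0$, $x+0\to x$, $x+(y+x)\to y$, $h(0)\to0$; $R_h$ is the single rule $h(x+y)\to h(x)+h(y)$. $ACh$ is the theory generated by associativity and commutativity of $+$ and $h(x+y)\approx h(x)+h(y)$; $AC$ is associativity and commutativity of $+$. For a rewrite system $R$ and theory $E$, $t\to_{R,E}t'$ iff there are a non-variable position $p$ of $t$, a rule $l\to r\in R$ and a substitution $\sigma$ with $t|_p=_E l\sigma$ and $t'=t[r\sigma]_p$. -}

module Defs where

open import Data.Nat using (ℕ)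
open import Data.Product using (_×_; _,_; Σ; ∃)
open import Data.List using (List; []; _∷_; _++_)
open import Data.List.Membership.Propositional using (_∈_)
open import Relation.Binary.PropositionalEquality using (_≡_)
open import Relation.Nullary using (¬_)

data Term : Set where
  var   : ℕ → Term
  const : ℕ → Term
  𝟘     : Term
  _⊕_   : Term → Term → Term
  h     : Term → Term

infixl 6 _⊕_
infix 8 _⟨_⟩
infix 4 _⊢_≈_

IsVar : Term → Set
IsVar t = Σ ℕ λ n → t ≡ var n

Subst : Set
Subst = ℕ → Term

_⟨_⟩ : Term → Subst → Term
var x   ⟨ σ ⟩ = σ x
const c ⟨ σ ⟩ = const c
𝟘       ⟨ σ ⟩ = 𝟘
(s ⊕ t) ⟨ σ ⟩ = (s ⟨ σ ⟩) ⊕ (t ⟨ σ ⟩)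
h t     ⟨ σ ⟩ = h (t ⟨ σ ⟩)

-- One-hole contexts (equivalently, positions p with t[_]_p).
data Ctx : Set where
  □    : Ctx
  _⊕ₗ_ : Ctx → Term → Ctx
  _⊕ᵣ_ : Term → Ctx → Ctx
  hᶜ   : Ctx → Ctx

plug : Ctx → Term → Term
plug □ u = u
plug (C ⊕ₗ t) u = plug C u ⊕ t
plug (t ⊕ᵣ C) u = t ⊕ plug C u
plug (hᶜ C) u = h (plug C u)

Rule : Set
Rule = Term × Term

x y z : Term
x = var 0
y = var 1
z = var 2

R₂ : List Rule
R₂ = (x ⊕ x , 𝟘) ∷ (x ⊕ 𝟘 , x) ∷ (x ⊕ (y ⊕ x) , y) ∷ (h 𝟘 , 𝟘) ∷ []

Rₕ : List Rule
Rₕ = (h (x ⊕ y) , h x ⊕ h y) ∷ []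

AC : List Rule
AC = (x ⊕ (y ⊕ z) , (x ⊕ y) ⊕ z) ∷ (x ⊕ y , y ⊕ x) ∷ []

ACh : List Rule
ACh = AC ++ ((h (x ⊕ y) , h x ⊕ h y) ∷ [])

data _⊢_≈_ (E : List Rule) : Term → Term → Set where
  ax    : ∀ {l r} → (l , r) ∈ E → (σ : Subst) → E ⊢ l ⟨ σ ⟩ ≈ r ⟨ σ ⟩
  refl  : ∀ {t} → E ⊢ t ≈ t
  sym   : ∀ {s t} → E ⊢ s ≈ t → E ⊢ t ≈ s
  trans : ∀ {s t u} → E ⊢ s ≈ t → E ⊢ t ≈ u → E ⊢ s ≈ u
  cong⊕ : ∀ {s s' t t'} → E ⊢ s ≈ s' → E ⊢ t ≈ t' → E ⊢ s ⊕ t ≈ s' ⊕ t'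
  congh : ∀ {s s'} → E ⊢ s ≈ s' → E ⊢ h s ≈ h s'

record Step (R E : List Rule) (t t' : Term) : Set where
  constructor step
  field
    C    : Ctx
    u    : Term
    l r  : Term
    σ    : Subst
    t≡   : t ≡ plug C u
    nonvar : ¬ IsVar u
    rule : (l , r) ∈ R
    match : E ⊢ u ≈ l ⟨ σ ⟩
    t'≡  : t' ≡ plug C (r ⟨ σ ⟩)

Reducible : (R E : List Rule) → Term → Set
Reducible R E t = ∃ λ t' → Step R E t t'

-- An Rₕ-step is an instance of the distributivity axiom of ACh, so s₁ =ACh s₂.
-- Flattening a term into the multiset of its atoms hᵏ(ℓ) (ℓ a variable, constant
-- or 0) identifies =ACh with multiset equality.  Every left-hand side of R₂, and
-- hence every term containing an R₂-redex modulo ACh, has an atom multiset with a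
-- repeated atom, 0 next to another atom, or an atom hᵏ⁺¹(0); conversely each of
-- these patterns makes a term R₂-reducible modulo ACh.  Being a property of the
-- multiset, the pattern passes from s₂ to s₁.
module Submission where

open import Data.Nat using (ℕ; zero; suc)
open import Data.Product using (_×_; _,_; ∃; ∃₂)
open import Data.Sum using (inj₁; inj₂)
open import Data.List using (List; []; _∷_; _++_; map; [_])
open import Data.List.Properties using (++-assoc; map-++)
open import Data.List.Membership.Propositional using (_∈_)
open import Data.List.Membership.Propositional.Properties using (∈-map⁻; ∈-++⁻; ∈-∃++)
open import Data.List.Relation.Unary.Any using (here; there)
open import Data.List.Relation.Binary.Subset.Propositional using (_⊆_)
open import Data.List.Relation.Binary.Subset.Propositional.Properties using (xs⊆xs++ys)
open import Data.List.Relation.Binary.Permutation.Propositional as ↭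
  using (_↭_; ↭-sym; ↭-trans; ↭-reflexive; prep; swap)
open import Data.List.Relation.Binary.Permutation.Propositional.Properties
  using (↭-empty-inv; ↭-length; ∈-resp-↭; ++⁺; ++⁺ʳ; shift; ++-comm; map⁺)
open import Relation.Binary.PropositionalEquality as ≡ using (_≡_)
open import Relation.Nullary using (¬_)
open import Defs

⊢-mono : ∀ {E E′ s t} → E ⊆ E′ → E ⊢ s ≈ t → E′ ⊢ s ≈ t
⊢-mono E⊆E′ (ax l≈r σ)  = ax (E⊆E′ l≈r) σ
⊢-mono E⊆E′ refl        = refl
⊢-mono E⊆E′ (sym p)     = sym (⊢-mono E⊆E′ p)
⊢-mono E⊆E′ (trans p q) = trans (⊢-mono E⊆E′ p) (⊢-mono E⊆E′ q)
⊢-mono E⊆E′ (cong⊕ p q) = cong⊕ (⊢-mono E⊆E′ p) (⊢-mono E⊆E′ q)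
⊢-mono E⊆E′ (congh p)   = congh (⊢-mono E⊆E′ p)

⊢-plug : ∀ {E a b} C → E ⊢ a ≈ b → E ⊢ plug C a ≈ plug C b
⊢-plug □        a≈b = a≈b
⊢-plug (C ⊕ₗ t) a≈b = cong⊕ (⊢-plug C a≈b) refl
⊢-plug (t ⊕ᵣ C) a≈b = cong⊕ refl (⊢-plug C a≈b)
⊢-plug (hᶜ C)   a≈b = congh (⊢-plug C a≈b)

xyz↦ : Term → Term → Term → Subst
xyz↦ a b c zero          = a
xyz↦ a b c (suc zero)    = b
xyz↦ a b c (suc (suc _)) = c

ACh-assoc : ∀ a b c → ACh ⊢ a ⊕ (b ⊕ c) ≈ (a ⊕ b) ⊕ c
ACh-assoc a b c = ax (here ≡.refl) (xyz↦ a b c)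

ACh-comm : ∀ a b → ACh ⊢ a ⊕ b ≈ b ⊕ a
ACh-comm a b = ax (there (here ≡.refl)) (xyz↦ a b a)

ACh-h-⊕ : ∀ a b → ACh ⊢ h (a ⊕ b) ≈ h a ⊕ h b
ACh-h-⊕ a b = ax (there (there (here ≡.refl))) (xyz↦ a b a)

Rₕ-step⇒ACh : ∀ {s t} → Step Rₕ AC s t → ACh ⊢ s ≈ t
Rₕ-step⇒ACh (step C u _ _ σ ≡.refl _ (here ≡.refl) u≈lσ ≡.refl) =
  ⊢-plug C (trans (⊢-mono (xs⊆xs++ys AC _) u≈lσ) (ACh-h-⊕ (σ 0) (σ 1)))
Rₕ-step⇒ACh (step _ _ _ _ _ _ _ (there ()) _ _)

module _ {R E : List Rule} where

  Reducible-⊕ˡ : ∀ {s} t → Reducible R E s → Reducible R E (s ⊕ t)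
  Reducible-⊕ˡ t (_ , step C u l r σ ≡.refl u≢var l→r u≈lσ ≡.refl) =
    _ , step (C ⊕ₗ t) u l r σ ≡.refl u≢var l→r u≈lσ ≡.refl

  Reducible-⊕ʳ : ∀ s {t} → Reducible R E t → Reducible R E (s ⊕ t)
  Reducible-⊕ʳ s (_ , step C u l r σ ≡.refl u≢var l→r u≈lσ ≡.refl) =
    _ , step (s ⊕ᵣ C) u l r σ ≡.refl u≢var l→r u≈lσ ≡.refl

  Reducible-h : ∀ {t} → Reducible R E t → Reducible R E (h t)
  Reducible-h (_ , step C u l r σ ≡.refl u≢var l→r u≈lσ ≡.refl) =
    _ , step (hᶜ C) u l r σ ≡.refl u≢var l→r u≈lσ ≡.refl

data Leaf : Set where
  var const : ℕ → Leaf
  𝟘         : Leaf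

-- (k , ℓ) stands for the term hᵏ(ℓ).
Atom : Set
Atom = ℕ × Leaf

raise : Atom → Atom
raise (k , ℓ) = suc k , ℓ

atoms : Term → List Atom
atoms (var n)   = [ 0 , var n ]
atoms (const c) = [ 0 , const c ]
atoms 𝟘         = [ 0 , 𝟘 ]
atoms (s ⊕ t)   = atoms s ++ atoms t
atoms (h t)     = map raise (atoms t)

⌜_⌝ : Atom → Term
⌜ zero , var n ⌝   = var n
⌜ zero , const c ⌝ = const c
⌜ zero , 𝟘 ⌝       = 𝟘
⌜ suc k , ℓ ⌝      = h ⌜ k , ℓ ⌝

-- The value 𝟘 on [] is never used: only sums of nonempty lists occur below.
sum : List Atom → Term
sum []           = 𝟘
sum (a ∷ [])     = ⌜ a ⌝
sum (a ∷ b ∷ bs) = ⌜ a ⌝ ⊕ sum (b ∷ bs)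

NonEmpty : List Atom → Set
NonEmpty xs = ∃₂ λ a as → xs ≡ a ∷ as

atoms-nonEmpty : ∀ t → NonEmpty (atoms t)
atoms-nonEmpty (var n)   = _ , _ , ≡.refl
atoms-nonEmpty (const c) = _ , _ , ≡.refl
atoms-nonEmpty 𝟘         = _ , _ , ≡.refl
atoms-nonEmpty (s ⊕ t) with a , as , eq ← atoms-nonEmpty s =
  a , as ++ atoms t , ≡.cong (_++ atoms t) eq
atoms-nonEmpty (h t)   with a , as , eq ← atoms-nonEmpty t =
  raise a , map raise as , ≡.cong (map raise) eq

atoms-⌜⌝ : ∀ a → atoms ⌜ a ⌝ ≡ [ a ]
atoms-⌜⌝ (zero , var n)   = ≡.refl
atoms-⌜⌝ (zero , const c) = ≡.refl
atoms-⌜⌝ (zero , 𝟘)       = ≡.refl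
atoms-⌜⌝ (suc k , ℓ)      = ≡.cong (map raise) (atoms-⌜⌝ (k , ℓ))

atoms-sum : ∀ a as → atoms (sum (a ∷ as)) ≡ a ∷ as
atoms-sum a []       = atoms-⌜⌝ a
atoms-sum a (b ∷ bs) = ≡.cong₂ _++_ (atoms-⌜⌝ a) (atoms-sum b bs)

atoms-sound : ∀ {s t} → ACh ⊢ s ≈ t → atoms s ↭ atoms t
atoms-sound (ax (here ≡.refl) σ) =
  ↭-reflexive (≡.sym (++-assoc (atoms (σ 0)) (atoms (σ 1)) (atoms (σ 2))))
atoms-sound (ax (there (here ≡.refl)) σ)         = ++-comm (atoms (σ 0)) (atoms (σ 1))
atoms-sound (ax (there (there (here ≡.refl))) σ) = ↭-reflexive (map-++ raise (atoms (σ 0)) (atoms (σ 1)))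
atoms-sound (ax (there (there (there ()))) σ)
atoms-sound refl        = ↭.refl
atoms-sound (sym p)     = ↭-sym (atoms-sound p)
atoms-sound (trans p q) = ↭-trans (atoms-sound p) (atoms-sound q)
atoms-sound (cong⊕ p q) = ++⁺ (atoms-sound p) (atoms-sound q)
atoms-sound (congh p)   = map⁺ raise (atoms-sound p)

sum-++ : ∀ {xs ys} → NonEmpty xs → NonEmpty ys → ACh ⊢ sum xs ⊕ sum ys ≈ sum (xs ++ ys)
sum-++ (a , []     , ≡.refl) (_ , _ , ≡.refl) = refl
sum-++ (a , x ∷ xs , ≡.refl) ys≢[] =
  trans (sym (ACh-assoc _ _ _)) (cong⊕ refl (sum-++ (x , xs , ≡.refl) ys≢[]))

sum-map-raise : ∀ {xs} → NonEmpty xs → ACh ⊢ h (sum xs) ≈ sum (map raise xs)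
sum-map-raise (a , []     , ≡.refl) = refl
sum-map-raise (a , x ∷ xs , ≡.refl) =
  trans (ACh-h-⊕ _ _) (cong⊕ refl (sum-map-raise (x , xs , ≡.refl)))

≈-sum-atoms : ∀ t → ACh ⊢ t ≈ sum (atoms t)
≈-sum-atoms (var n)   = refl
≈-sum-atoms (const c) = refl
≈-sum-atoms 𝟘         = refl
≈-sum-atoms (s ⊕ t)   =
  trans (cong⊕ (≈-sum-atoms s) (≈-sum-atoms t)) (sum-++ (atoms-nonEmpty s) (atoms-nonEmpty t))
≈-sum-atoms (h t)     = trans (congh (≈-sum-atoms t)) (sum-map-raise (atoms-nonEmpty t))

sum-∷⁺ : ∀ x {xs ys} → xs ↭ ys → ACh ⊢ sum xs ≈ sum ys → ACh ⊢ sum (x ∷ xs) ≈ sum (x ∷ ys)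
sum-∷⁺ x {[]}    xs↭ys _ with ≡.refl ← ↭-empty-inv (↭-sym xs↭ys) = refl
sum-∷⁺ x {_ ∷ _} {[]} xs↭ys _ with () ← ↭-empty-inv xs↭ys
sum-∷⁺ x {_ ∷ _} {_ ∷ _} _ xs≈ys = cong⊕ refl xs≈ys

sum-swap : ∀ x y {xs ys} → xs ↭ ys → ACh ⊢ sum xs ≈ sum ys →
           ACh ⊢ sum (x ∷ y ∷ xs) ≈ sum (y ∷ x ∷ ys)
sum-swap x y {[]}    xs↭ys _ with ≡.refl ← ↭-empty-inv (↭-sym xs↭ys) = ACh-comm _ _
sum-swap x y {_ ∷ _} {[]} xs↭ys _ with () ← ↭-empty-inv xs↭ys
sum-swap x y {_ ∷ _} {_ ∷ _} _ xs≈ys =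
  trans (ACh-assoc _ _ _)
    (trans (cong⊕ (ACh-comm _ _) refl) (trans (sym (ACh-assoc _ _ _)) (cong⊕ refl (cong⊕ refl xs≈ys))))

sum-↭ : ∀ {xs ys} → xs ↭ ys → ACh ⊢ sum xs ≈ sum ys
sum-↭ ↭.refl        = refl
sum-↭ (prep x p)    = sum-∷⁺ x p (sum-↭ p)
sum-↭ (swap x y p)  = sum-swap x y p (sum-↭ p)
sum-↭ (↭.trans p q) = trans (sum-↭ p) (sum-↭ q)

atoms-complete : ∀ {s t} → atoms s ↭ atoms t → ACh ⊢ s ≈ t
atoms-complete {s} {t} p = trans (≈-sum-atoms s) (trans (sum-↭ p) (sym (≈-sum-atoms t)))

-- The third case covers redexes that need not appear literally: h(0 ⊕ a) has the
-- atom h(0) and is reducible inside, at 0 ⊕ a.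
data R₂Pattern (xs : List Atom) : Set where
  duplicate : ∀ a rest → xs ↭ a ∷ a ∷ rest → R₂Pattern xs
  𝟘-summand : ∀ b rest → xs ↭ (0 , 𝟘) ∷ b ∷ rest → R₂Pattern xs
  h𝟘-atom   : ∀ k rest → xs ↭ (suc k , 𝟘) ∷ rest → R₂Pattern xs

R₂Pattern-resp-↭ : ∀ {xs ys} → xs ↭ ys → R₂Pattern xs → R₂Pattern ys
R₂Pattern-resp-↭ xs↭ys (duplicate a rest p) = duplicate a rest (↭-trans (↭-sym xs↭ys) p)
R₂Pattern-resp-↭ xs↭ys (𝟘-summand b rest p) = 𝟘-summand b rest (↭-trans (↭-sym xs↭ys) p)
R₂Pattern-resp-↭ xs↭ys (h𝟘-atom k rest p)   = h𝟘-atom k rest (↭-trans (↭-sym xs↭ys) p)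

R₂Pattern-++ʳ : ∀ {xs} ys → R₂Pattern xs → R₂Pattern (xs ++ ys)
R₂Pattern-++ʳ ys (duplicate a rest p) = duplicate a (rest ++ ys) (++⁺ʳ ys p)
R₂Pattern-++ʳ ys (𝟘-summand b rest p) = 𝟘-summand b (rest ++ ys) (++⁺ʳ ys p)
R₂Pattern-++ʳ ys (h𝟘-atom k rest p)   = h𝟘-atom k (rest ++ ys) (++⁺ʳ ys p)

R₂Pattern-++ˡ : ∀ xs {ys} → R₂Pattern ys → R₂Pattern (xs ++ ys)
R₂Pattern-++ˡ xs {ys} p = R₂Pattern-resp-↭ (++-comm ys xs) (R₂Pattern-++ʳ xs p)

R₂Pattern-map-raise : ∀ {xs} → R₂Pattern xs → R₂Pattern (map raise xs)
R₂Pattern-map-raise (duplicate a rest p) = duplicate (raise a) (map raise rest) (map⁺ raise p)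
R₂Pattern-map-raise (𝟘-summand b rest p) = h𝟘-atom 0 (map raise (b ∷ rest)) (map⁺ raise p)
R₂Pattern-map-raise (h𝟘-atom k rest p)   = h𝟘-atom (suc k) (map raise rest) (map⁺ raise p)

R₂Pattern-plug : ∀ C {a} → R₂Pattern (atoms a) → R₂Pattern (atoms (plug C a))
R₂Pattern-plug □        p = p
R₂Pattern-plug (C ⊕ₗ t) p = R₂Pattern-++ʳ (atoms t) (R₂Pattern-plug C p)
R₂Pattern-plug (t ⊕ᵣ C) p = R₂Pattern-++ˡ (atoms t) (R₂Pattern-plug C p)
R₂Pattern-plug (hᶜ C)   p = R₂Pattern-map-raise (R₂Pattern-plug C p)

R₂Pattern-repeat : ∀ {xs} ys → NonEmpty xs → R₂Pattern (xs ++ ys ++ xs)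
R₂Pattern-repeat ys (a , as , ≡.refl) =
  duplicate a ((as ++ ys) ++ as)
    (prep a (↭-trans (↭-reflexive (≡.sym (++-assoc as ys (a ∷ as)))) (shift a (as ++ ys) as)))

R₂Pattern-lhs : ∀ {l r} → (l , r) ∈ R₂ → ∀ σ → R₂Pattern (atoms (l ⟨ σ ⟩))
R₂Pattern-lhs (here ≡.refl) σ = R₂Pattern-repeat [] (atoms-nonEmpty (σ 0))
R₂Pattern-lhs (there (here ≡.refl)) σ with a , as , eq ← atoms-nonEmpty (σ 0) =
  𝟘-summand a as (↭-trans (↭-reflexive (≡.cong (_++ [ 0 , 𝟘 ]) eq)) (++-comm (a ∷ as) [ 0 , 𝟘 ]))
R₂Pattern-lhs (there (there (here ≡.refl))) σ = R₂Pattern-repeat (atoms (σ 1)) (atoms-nonEmpty (σ 0))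
R₂Pattern-lhs (there (there (there (here ≡.refl)))) σ = h𝟘-atom 0 [] ↭.refl
R₂Pattern-lhs (there (there (there (there ())))) σ

R₂-step⇒R₂Pattern : ∀ {s t} → Step R₂ ACh s t → R₂Pattern (atoms s)
R₂-step⇒R₂Pattern (step C u l r σ ≡.refl _ l→r u≈lσ _) =
  R₂Pattern-plug C (R₂Pattern-resp-↭ (↭-sym (atoms-sound u≈lσ)) (R₂Pattern-lhs l→r σ))

¬IsVar-two-atoms : ∀ t {a b rest} → atoms t ↭ a ∷ b ∷ rest → ¬ IsVar t
¬IsVar-two-atoms t p (n , ≡.refl) with () ← ↭-length p

reducible-at-root : ∀ t {l r} → (l , r) ∈ R₂ → ∀ σ → ¬ IsVar t →
                    atoms t ↭ atoms (l ⟨ σ ⟩) → Reducible R₂ ACh t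
reducible-at-root t {l} {r} l→r σ t≢var p =
  r ⟨ σ ⟩ , step □ t l r σ ≡.refl t≢var l→r (atoms-complete p) ≡.refl

duplicate-reducible : ∀ t a rest → atoms t ↭ a ∷ a ∷ rest → Reducible R₂ ACh t
duplicate-reducible t a [] p =
  reducible-at-root t (here ≡.refl) (λ _ → ⌜ a ⌝) (¬IsVar-two-atoms t p)
    (↭-trans p (↭-reflexive (≡.sym (≡.cong₂ _++_ (atoms-⌜⌝ a) (atoms-⌜⌝ a)))))
duplicate-reducible t a (b ∷ bs) p =
  reducible-at-root t (there (there (here ≡.refl))) (xyz↦ ⌜ a ⌝ (sum (b ∷ bs)) 𝟘) (¬IsVar-two-atoms t p)
    (↭-trans p (↭-trans (prep a (++-comm [ a ] (b ∷ bs)))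
      (↭-reflexive (≡.sym (≡.cong₂ _++_ (atoms-⌜⌝ a) (≡.cong₂ _++_ (atoms-sum b bs) (atoms-⌜⌝ a)))))))

𝟘-summand-reducible : ∀ t b rest → atoms t ↭ (0 , 𝟘) ∷ b ∷ rest → Reducible R₂ ACh t
𝟘-summand-reducible t b rest p =
  reducible-at-root t (there (here ≡.refl)) (λ _ → sum (b ∷ rest)) (¬IsVar-two-atoms t p)
    (↭-trans p (↭-trans (++-comm [ 0 , 𝟘 ] (b ∷ rest))
      (↭-reflexive (≡.sym (≡.cong (_++ [ 0 , 𝟘 ]) (atoms-sum b rest))))))

∈⇒↭-∷ : ∀ {A : Set} {v : A} {xs} → v ∈ xs → ∃ λ ys → xs ↭ v ∷ ys
∈⇒↭-∷ v∈xs with us , ws , ≡.refl ← ∈-∃++ v∈xs = us ++ ws , shift _ us ws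

∈-++-nonEmpty⇒↭ : ∀ {v : Atom} {xs ys} → v ∈ xs → NonEmpty ys → ∃₂ λ b rest → xs ++ ys ↭ v ∷ b ∷ rest
∈-++-nonEmpty⇒↭ {v} v∈xs (c , cs , ≡.refl) =
  let ys , xs↭ = ∈⇒↭-∷ v∈xs in
  c , ys ++ cs , ↭-trans (++⁺ʳ (c ∷ cs) xs↭) (prep v (shift c ys cs))

∈-atoms-⊕⇒↭ : ∀ s t {v} → v ∈ atoms (s ⊕ t) → ∃₂ λ b rest → atoms (s ⊕ t) ↭ v ∷ b ∷ rest
∈-atoms-⊕⇒↭ s t v∈ with ∈-++⁻ (atoms s) v∈
... | inj₁ v∈s = ∈-++-nonEmpty⇒↭ v∈s (atoms-nonEmpty t)
... | inj₂ v∈t with b , rest , p ← ∈-++-nonEmpty⇒↭ v∈t (atoms-nonEmpty s) =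
  b , rest , ↭-trans (++-comm (atoms s) (atoms t)) p

𝟘-atom⇒h-reducible : ∀ t → (0 , 𝟘) ∈ atoms t → Reducible R₂ ACh (h t)
𝟘-atom⇒h-reducible (var n)   (here ())
𝟘-atom⇒h-reducible (var n)   (there ())
𝟘-atom⇒h-reducible (const c) (here ())
𝟘-atom⇒h-reducible (const c) (there ())
𝟘-atom⇒h-reducible 𝟘 _ =
  𝟘 , step □ (h 𝟘) (h 𝟘) 𝟘 (λ _ → 𝟘) ≡.refl (λ { (_ , ()) })
        (there (there (there (here ≡.refl)))) refl ≡.refl
𝟘-atom⇒h-reducible (s ⊕ t) 𝟘∈ with b , rest , p ← ∈-atoms-⊕⇒↭ s t 𝟘∈ =
  Reducible-h (𝟘-summand-reducible (s ⊕ t) b rest p)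
𝟘-atom⇒h-reducible (h t) 𝟘∈ with _ , _ , () ← ∈-map⁻ raise 𝟘∈

h𝟘-atom⇒reducible : ∀ t k → (suc k , 𝟘) ∈ atoms t → Reducible R₂ ACh t
h𝟘-atom⇒reducible (var n)   k (here ())
h𝟘-atom⇒reducible (var n)   k (there ())
h𝟘-atom⇒reducible (const c) k (here ())
h𝟘-atom⇒reducible (const c) k (there ())
h𝟘-atom⇒reducible 𝟘         k (here ())
h𝟘-atom⇒reducible 𝟘         k (there ())
h𝟘-atom⇒reducible (s ⊕ t) k h𝟘∈ with ∈-++⁻ (atoms s) h𝟘∈
... | inj₁ h𝟘∈s = Reducible-⊕ˡ t (h𝟘-atom⇒reducible s k h𝟘∈s)
... | inj₂ h𝟘∈t = Reducible-⊕ʳ s (h𝟘-atom⇒reducible t k h𝟘∈t)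
h𝟘-atom⇒reducible (h t) zero    h𝟘∈ with (_ , _) , 𝟘∈t , ≡.refl ← ∈-map⁻ raise h𝟘∈ =
  𝟘-atom⇒h-reducible t 𝟘∈t
h𝟘-atom⇒reducible (h t) (suc k) h𝟘∈ with (_ , _) , h𝟘∈t , ≡.refl ← ∈-map⁻ raise h𝟘∈ =
  Reducible-h (h𝟘-atom⇒reducible t k h𝟘∈t)

R₂Pattern⇒reducible : ∀ t → R₂Pattern (atoms t) → Reducible R₂ ACh t
R₂Pattern⇒reducible t (duplicate a rest p) = duplicate-reducible t a rest p
R₂Pattern⇒reducible t (𝟘-summand b rest p) = 𝟘-summand-reducible t b rest p
R₂Pattern⇒reducible t (h𝟘-atom k rest p)   = h𝟘-atom⇒reducible t k (∈-resp-↭ (↭-sym p) (here ≡.refl))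

mainTheorem18 : (s₁ s₂ s₃ : Term) → Step Rₕ AC s₁ s₂ → Step R₂ ACh s₂ s₃ → Reducible R₂ ACh s₁
mainTheorem18 s₁ s₂ s₃ s₁→s₂ s₂→s₃ =
  R₂Pattern⇒reducible s₁ (R₂Pattern-resp-↭ s₂↭s₁ (R₂-step⇒R₂Pattern s₂→s₃))
  where
  s₂↭s₁ : atoms s₂ ↭ atoms s₁
  s₂↭s₁ = atoms-sound (sym (Rₕ-step⇒ACh s₁→s₂))
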